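{- Let $\mathcal{H}$ be a connected hypergraph. If $\mathcal{H}$ has at least one vertex of degree at least $3$, then $\gamma_{P_I}(\mathcal{H})\le\gamma_P(\mathcal{H})\le|\{v\in V(\mathcal{H}):\deg(v)\ge 3\}|$. If $\deg(v)\le 2$ for all vertices $v$ of $\mathcal{H}$, then $\gamma_{P_I}(\mathcal{H})=\gamma_P(\mathcal{H})=1$.
   Context: A hypergraph $\mathcal{H}=(V,E)$ has finite vertex set $V$ and edges nonempty subsets of $V$; throughout, hypergraphs are reduced (no edge is contained in another distinct edge) and have at least one edge. $\deg(v)$ is the number of edges containing $v$. A path is a sequence $v_1,e_1,v_2,\dots,e_\ell,v_{\ell+1}$ of distinct vertices and distinct edges with $v_i,v_{i+1}\in e_i$; $\mathcal{H}$ is connected if any two vertices are joined by a path. $N[a]=\bigcup_{a\in e\in E}e$, $N(a)=N[a]\setminus\{a\}$. Power domination: given $S_0\subseteq V$, first all vertices of $\bigcup_{v\in S_0}N[v]$ become observed; then repeatedly, if all unobserved neighbors of an observed vertex $v$ lie in one edge incident to $v$, they become observed. $\gamma_P(\mathcal{H})$ is the minimum size of an $S_0$ making all vertices observed. Infectious power domination: given $S_0$, set $S=\bigcup_{v\in S_0}N[v]$; then while some nonempty $A\subseteq S$ and edge $e$ satisfy $A\subseteq e$ and [every vertex $v\notin S$ such that $A\cup\{v\}$ is contained in some edge lies in $e$], add the vertices of $e$ to $S$. $\gamma_{P_I}(\mathcal{H})$ is the minimum size of an $S_0$ with $S=V$ at termination. -}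

module Defs where

open import Data.Nat using (ℕ; zero; suc; _≤_; NonZero)
open import Data.Fin using (Fin; zero; suc; fromℕ; inject₁)
open import Data.Fin.Subset using (Subset; _∈_; _∉_; _⊆_; _∪_; ∣_∣; Nonempty)
open import Data.Fin.Subset.Properties using (_∈?_)
open import Data.Vec using (tabulate)
open import Data.Product using (Σ; ∃; ∃-syntax; _×_; _,_)
open import Data.Sum using (_⊎_)
open import Relation.Nullary using (¬_; does)
open import Relation.Binary.PropositionalEquality using (_≡_; _≢_)
open import Relation.Binary.Construct.Closure.ReflexiveTransitive using (Star)
open import Function.Definitions using (Injective)

record Hypergraph : Set where
  field
    n        : ℕ
    m        : ℕ
    edge     : Fin m → Subset n
    nonempty : ∀ i → Nonempty (edge i)
    reduced  : ∀ i j → edge i ⊆ edge j → i ≡ j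
    hasEdge  : NonZero m

module _ (H : Hypergraph) where
  open Hypergraph H

  deg : Fin n → ℕ
  deg v = ∣ tabulate (λ i → does (v ∈? edge i)) ∣

  highDeg : Subset n
  highDeg = tabulate (λ v → does (3 Data.Nat.≤? deg v))

  N[_] : Fin n → Fin n → Set
  N[ a ] x = ∃[ i ] (a ∈ edge i × x ∈ edge i)

  N⟨_⟩ : Fin n → Fin n → Set
  N⟨ a ⟩ x = N[ a ] x × x ≢ a

  Path : Fin n → Fin n → Set
  Path u v =
    Σ ℕ λ ℓ → Σ (Fin (suc ℓ) → Fin n) λ vs → Σ (Fin ℓ → Fin m) λ es →
      Injective _≡_ _≡_ vs × Injective _≡_ _≡_ es ×
      vs zero ≡ u × vs (fromℕ ℓ) ≡ v ×
      (∀ k → vs (inject₁ k) ∈ edge (es k) × vs (suc k) ∈ edge (es k))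

  Connected : Set
  Connected = ∀ u v → Path u v

  InitialSet : Subset n → Subset n → Set
  InitialSet S0 S = ∀ x → (x ∈ S → ∃[ v ] (v ∈ S0 × N[ v ] x))
                        × (∃[ v ] (v ∈ S0 × N[ v ] x) → x ∈ S)

  PDStep : Subset n → Subset n → Set
  PDStep S S' = ∃[ v ] ∃[ i ] (v ∈ S × v ∈ edge i ×
                  (∀ x → N⟨ v ⟩ x → x ∉ S → x ∈ edge i) ×
                  (∀ x → (x ∈ S' → x ∈ S ⊎ N⟨ v ⟩ x) × (x ∈ S ⊎ N⟨ v ⟩ x → x ∈ S')))

  IPDStep : Subset n → Subset n → Set
  IPDStep S S' = ∃[ A ] ∃[ i ] (Nonempty A × A ⊆ S × A ⊆ edge i ×
                   (∀ v → v ∉ S → (∃[ j ] (A ⊆ edge j × v ∈ edge j)) → v ∈ edge i) ×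
                   S' ≡ S ∪ edge i)

  PowerDominating : Subset n → Set
  PowerDominating S0 = ∃[ S ] ∃[ T ] (InitialSet S0 S × Star PDStep S T × (∀ x → x ∈ T))

  InfPowerDominating : Subset n → Set
  InfPowerDominating S0 = ∃[ S ] ∃[ T ] (InitialSet S0 S × Star IPDStep S T × (∀ x → x ∈ T))

  IsMinSize : (Subset n → Set) → ℕ → Set
  IsMinSize P k = (∃[ S0 ] (P S0 × ∣ S0 ∣ ≡ k)) × (∀ S0 → P S0 → k ≤ ∣ S0 ∣)

  IsγP : ℕ → Set
  IsγP = IsMinSize PowerDominating

  IsγPI : ℕ → Set
  IsγPI = IsMinSize InfPowerDominating

-- Call an edge "open" for an observed set S if it is not contained
-- in S.  We maintain the invariant that every observed vertex lies in at
-- most one open edge and every unobserved vertex has degree at most 2.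
-- While S is not everything, connectivity yields an edge f meeting both S
-- and its complement; a vertex w ∈ S ∩ f then has f as its only open edge,
-- so a power domination step from w observes all of f, and the invariant
-- survives adding f.  Starting sets satisfying the invariant are the
-- vertices of degree ≥ 3 (if any) or a single vertex (if all degrees are
-- ≤ 2); hence both are power dominating.  Every power domination run is
-- simulated by an infectious one (take A = {v}), giving γ_{P_I} ≤ γ_P, and
-- every dominating set is nonempty, giving the lower bound 1.
module Submission where

open import Defs
open import Data.Nat using (ℕ; _≤_)
open import Data.Fin.Subset using (∣_∣)
open import Data.Product using (∃-syntax; _×_)
open import Data.Sum using (_⊎_)

open import Data.Nat using (zero; suc; _<_; z≤n; s≤s; NonZero) renaming (_≤?_ to _≤ℕ?_; _≟_ to _≟ℕ_)
open import Data.Nat.Properties using (≤-trans; ≤-pred; ≮⇒≥; ≰⇒>; <⇒≢; <⇒≱; anyUpTo?)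
open import Data.Nat.Induction using (<-wellFounded)
open import Data.Fin using (Fin; zero; suc; fromℕ; inject₁) renaming (_≟_ to _≟F_)
open import Data.Fin.Subset using (Subset; _∈_; _∉_; _⊆_; _⊂_; _⊃_; _∪_; _-_; ⁅_⁆; Nonempty)
open import Data.Fin.Subset.Properties
  using (_∈?_; nonempty?; _⊆?_; _⊂?_; anySubset?; ⊆-antisym; Empty-unique; ∣⊥∣≡0;
         x∈⁅x⁆; x∈⁅y⁆⇒x≡y; ∣⁅x⁆∣≡1; p⊆p∪q; q⊆p∪q; x∈p∪q⁻; x∈p∧x≢y⇒x∈p-y; x∈p⇒∣p-x∣<∣p∣)
open import Data.Fin.Subset.Induction using (⊃-wellFounded)
open import Data.Fin.Properties using (any?; all?; ¬∀⟶∃¬)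
open import Data.Vec using (tabulate)
open import Function using (_∘′_)
open import Data.Vec.Properties using (lookup∘tabulate; []=⇒lookup; lookup⇒[]=; ≡-dec)
open import Data.Bool using (true) renaming (_≟_ to _≟B_)
open import Data.Product using (_,_; proj₁; proj₂)
open import Data.Sum using (inj₁; inj₂) renaming (map to map-⊎)
open import Data.Empty using (⊥-elim)
open import Relation.Nullary using (¬_; Dec; yes; no; does)
open import Relation.Nullary.Decidable using (_×-dec_; _⊎-dec_; _→-dec_; ¬?; map′)
open import Relation.Binary.PropositionalEquality using (_≡_; _≢_; refl; sym; trans; subst; cong)
open import Relation.Binary.Construct.Closure.ReflexiveTransitive using (Star; ε; _◅_)
open import Induction.WellFounded using (Acc; acc)

-- The subset of Fin n cut out by a decidable predicate; `deg` and
-- `highDeg` in Defs are of exactly this shape.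
⟦_⟧ : ∀ {n} {P : Fin n → Set} → (∀ x → Dec (P x)) → Subset n
⟦ P? ⟧ = tabulate (λ x → does (P? x))

∈⟦⟧⁻ : ∀ {n} {P : Fin n → Set} (P? : ∀ x → Dec (P x)) {x} → x ∈ ⟦ P? ⟧ → P x
∈⟦⟧⁻ P? {x} x∈ with P? x | trans (sym (lookup∘tabulate (λ y → does (P? y)) x)) ([]=⇒lookup x∈)
... | yes p | _ = p

∈⟦⟧⁺ : ∀ {n} {P : Fin n → Set} (P? : ∀ x → Dec (P x)) {x} → P x → x ∈ ⟦ P? ⟧
∈⟦⟧⁺ P? {x} p = lookup⇒[]= x _ (trans (lookup∘tabulate (λ y → does (P? y)) x) (holds (P? x)))
  where
  holds : (d : Dec _) → does d ≡ true
  holds (yes _) = refl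
  holds (no ¬p) = ⊥-elim (¬p p)

some-index : ∀ {k} → NonZero k → Fin k
some-index {suc _} _ = zero

Full : ∀ {n} → Subset n → Set
Full T = ∀ x → x ∈ T

member-counts : ∀ {n k} {p : Subset n} {x} → x ∈ p → k ≤ ∣ p - x ∣ → suc k ≤ ∣ p ∣
member-counts x∈p k≤ = ≤-trans (s≤s k≤) (x∈p⇒∣p-x∣<∣p∣ x∈p)

three-members : ∀ {n} {p : Subset n} {a b c} → a ∈ p → b ∈ p → c ∈ p →
                a ≢ b → a ≢ c → b ≢ c → 3 ≤ ∣ p ∣
three-members a∈ b∈ c∈ a≢b a≢c b≢c =
  member-counts a∈ (member-counts (x∈p∧x≢y⇒x∈p-y b∈ (a≢b ∘′ sym))
    (member-counts (x∈p∧x≢y⇒x∈p-y (x∈p∧x≢y⇒x∈p-y c∈ (a≢c ∘′ sym)) (b≢c ∘′ sym)) z≤n))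

positive-size⇒nonempty : ∀ {n} (p : Subset n) → 1 ≤ ∣ p ∣ → Nonempty p
positive-size⇒nonempty {n} p 1≤ with nonempty? p
... | yes ne = ne
... | no empty = ⊥-elim (<⇒≢ 1≤ (sym (trans (cong ∣_∣ (Empty-unique empty)) (∣⊥∣≡0 n))))

⊆∧⊄⇒≡ : ∀ {n} {S S' : Subset n} → S ⊆ S' → ¬ (S ⊂ S') → S' ≡ S
⊆∧⊄⇒≡ {S = S} {S'} S⊆S' not-strict = ⊆-antisym back S⊆S'
  where
  back : ∀ {x} → x ∈ S' → x ∈ S
  back {x} x∈S' with x ∈? S
  ... | yes x∈S = x∈S
  ... | no x∉S = ⊥-elim (not-strict (S⊆S' , x , x∈S' , x∉S))

module Least {Q : ℕ → Set} (Q? : ∀ k → Dec (Q k)) where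

  least-below : ∀ N → Acc _<_ N → Q N → ∃[ k ] (Q k × (∀ j → Q j → k ≤ j))
  least-below N (acc smaller) qN with anyUpTo? Q? N
  ... | yes (j , j<N , qj) = least-below j (smaller j<N) qj
  ... | no none = N , qN , λ j qj → ≮⇒≥ (λ j<N → none (j , j<N , qj))

  least : ∀ N → Q N → ∃[ k ] (Q k × (∀ j → Q j → k ≤ j))
  least N = least-below N (<-wellFounded N)

-- For a step relation on subsets that only ever adds vertices, it is
-- decidable whether the full set is reachable: steps that add nothing can
-- be skipped, and strictly growing chains are well founded.
module Reachability {n} (Step : Subset n → Subset n → Set)
                    (step? : ∀ S S' → Dec (Step S S'))
                    (inflationary : ∀ {S S'} → Step S S' → S ⊆ S') where

  Reachable : Subset n → Set
  Reachable S = ∃[ T ] (Star Step S T × Full T)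

  first-growing-step : ∀ {S T} → ¬ Full S → Star Step S T → Full T →
                       ∃[ S' ] (Step S S' × S ⊂ S' × Reachable S')
  first-growing-step not-full ε full = ⊥-elim (not-full full)
  first-growing-step {S} {T} not-full (_◅_ {j = S'} step rest) full with S ⊂? S'
  ... | yes grows = S' , step , grows , T , rest , full
  ... | no stalls with ⊆∧⊄⇒≡ (inflationary step) stalls
  ...   | refl = first-growing-step not-full rest full

  reachable-from? : ∀ S → Acc _⊃_ S → Dec (Reachable S)
  reachable-from? S (acc larger) with all? (λ x → x ∈? S)
  ... | yes full = yes (S , ε , full)
  ... | no not-full =
        map′ (λ (_ , step , _ , T , rest , full) → T , step ◅ rest , full)
             (λ (_ , run , full) → first-growing-step not-full run full)
             (anySubset? growing-step?)
    where
    growing-step? : ∀ S' → Dec (Step S S' × S ⊂ S' × Reachable S')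
    growing-step? S' with S ⊂? S'
    ... | yes grows = map′ (λ (step , r) → step , grows , r) (λ (step , _ , r) → step , r)
                           (step? S S' ×-dec reachable-from? S' (larger grows))
    ... | no stalls = no (λ (_ , grows , _) → stalls grows)

  reachable? : ∀ S → Dec (Reachable S)
  reachable? S = reachable-from? S (⊃-wellFounded S)

module _ (H : Hypergraph) where
  open Hypergraph H

  minimum-exists : (P : Subset n → Set) → (∀ S → Dec (P S)) → ∀ S0 → P S0 →
                   ∃[ k ] IsMinSize H P k
  minimum-exists P P? S0 pS0
    with Least.least (λ k → anySubset? (λ S → P? S ×-dec (∣ S ∣ ≟ℕ k))) ∣ S0 ∣ (S0 , pS0 , refl)
  ... | k , witness , minimal = k , witness , λ S pS → minimal ∣ S ∣ (S , pS , refl)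

  closed-nbh? : ∀ v x → Dec (N[_] H v x)
  closed-nbh? v x = any? (λ i → (v ∈? edge i) ×-dec (x ∈? edge i))

  open-nbh? : ∀ v x → Dec (N⟨_⟩ H v x)
  open-nbh? v x = closed-nbh? v x ×-dec ¬? (x ≟F v)

  dominated? : ∀ S0 x → Dec (∃[ v ] (v ∈ S0 × N[_] H v x))
  dominated? S0 x = any? (λ v → (v ∈? S0) ×-dec closed-nbh? v x)

  initial : Subset n → Subset n
  initial S0 = ⟦ dominated? S0 ⟧

  initial-spec : ∀ S0 → InitialSet H S0 (initial S0)
  initial-spec S0 x = ∈⟦⟧⁻ (dominated? S0) , ∈⟦⟧⁺ (dominated? S0)

  initial-unique : ∀ {S0 S} → InitialSet H S0 S → S ≡ initial S0
  initial-unique {S0} spec =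
    ⊆-antisym (λ {x} x∈ → ∈⟦⟧⁺ (dominated? S0) (proj₁ (spec x) x∈))
              (λ {x} x∈ → proj₂ (spec x) (∈⟦⟧⁻ (dominated? S0) x∈))

  pd-step? : ∀ S S' → Dec (PDStep H S S')
  pd-step? S S' = any? λ v → any? λ i → (v ∈? S) ×-dec ((v ∈? edge i) ×-dec
     (all? (λ x → open-nbh? v x →-dec (¬? (x ∈? S) →-dec (x ∈? edge i))) ×-dec
      all? (λ x → ((x ∈? S') →-dec ((x ∈? S) ⊎-dec open-nbh? v x))
           ×-dec (((x ∈? S) ⊎-dec open-nbh? v x) →-dec (x ∈? S')))))

  ipd-step? : ∀ S S' → Dec (IPDStep H S S')
  ipd-step? S S' = anySubset? λ A → any? λ i → nonempty? A ×-dec ((A ⊆? S) ×-dec ((A ⊆? edge i) ×-dec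
     (all? (λ v → ¬? (v ∈? S) →-dec (any? (λ j → (A ⊆? edge j) ×-dec (v ∈? edge j)) →-dec (v ∈? edge i)))
      ×-dec ≡-dec _≟B_ S' (S ∪ edge i))))

  pd-inflationary : ∀ {S S'} → PDStep H S S' → S ⊆ S'
  pd-inflationary (_ , _ , _ , _ , _ , spec) {x} x∈S = proj₂ (spec x) (inj₁ x∈S)

  ipd-inflationary : ∀ {S S'} → IPDStep H S S' → S ⊆ S'
  ipd-inflationary (_ , i , _ , _ , _ , _ , refl) = p⊆p∪q (edge i)

  module PD = Reachability (PDStep H) pd-step? pd-inflationary
  module IPD = Reachability (IPDStep H) ipd-step? ipd-inflationary

  dominating? : ∀ {Step : Subset n → Subset n → Set} →
                (∀ S → Dec (∃[ T ] (Star Step S T × Full T))) →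
                ∀ S0 → Dec (∃[ S ] ∃[ T ] (InitialSet H S0 S × Star Step S T × Full T))
  dominating? {Step} reachable? S0 =
    map′ (λ (T , run , full) → initial S0 , T , initial-spec S0 , run , full)
         (λ (S , T , spec , run , full) →
            subst (λ X → ∃[ T ] (Star Step X T × Full T)) (initial-unique spec) (T , run , full))
         (reachable? (initial S0))

  power-dominating? : ∀ S0 → Dec (PowerDominating H S0)
  power-dominating? = dominating? PD.reachable?

  inf-power-dominating? : ∀ S0 → Dec (InfPowerDominating H S0)
  inf-power-dominating? = dominating? IPD.reachable?

  -- An infectious run from any R ⊇ S keeps up with a power domination run
  -- from S: the step at v through edge i is mimicked with A = {v}.
  simulate : ∀ {S T R} → Star (PDStep H) S T → S ⊆ R →
             ∃[ T' ] (Star (IPDStep H) R T' × T ⊆ T')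
  simulate {R = R} ε S⊆R = R , ε , S⊆R
  simulate {S} {R = R} (_◅_ {j = S'} (v , i , v∈S , v∈i , forced , spec) rest) S⊆R
    with simulate rest S'⊆R∪i
    where
    S'⊆R∪i : S' ⊆ R ∪ edge i
    S'⊆R∪i {x} x∈S' with proj₁ (spec x) x∈S' | x ∈? S
    ... | _ | yes x∈S = p⊆p∪q (edge i) (S⊆R x∈S)
    ... | inj₁ x∈S | no x∉S = ⊥-elim (x∉S x∈S)
    ... | inj₂ x∼v | no x∉S = q⊆p∪q R (edge i) (forced x x∼v x∉S)
  ... | T' , run , T⊆T' = T' , step ◅ run , T⊆T'
    where
    only-v : ∀ {X} → v ∈ X → ⁅ v ⁆ ⊆ X
    only-v v∈X x∈ = subst (_∈ _) (sym (x∈⁅y⁆⇒x≡y v x∈)) v∈X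
    infected : ∀ w → w ∉ R → ∃[ j ] (⁅ v ⁆ ⊆ edge j × w ∈ edge j) → w ∈ edge i
    infected w w∉R (j , v∈j , w∈j) =
      forced w ((j , v∈j (x∈⁅x⁆ v) , w∈j) , λ { refl → w∉R (S⊆R v∈S) }) (λ w∈S → w∉R (S⊆R w∈S))
    step : IPDStep H R (R ∪ edge i)
    step = ⁅ v ⁆ , i , (v , x∈⁅x⁆ v) , only-v (S⊆R v∈S) , only-v v∈i , infected , refl

  pd⇒ipd : ∀ S0 → PowerDominating H S0 → InfPowerDominating H S0
  pd⇒ipd S0 (S , T , spec , run , full) with simulate run (λ x∈ → x∈)
  ... | T' , run' , T⊆T' = S , T' , spec , run' , λ x → T⊆T' (full x)

  AtMostTwoEdges : Fin n → Set
  AtMostTwoEdges w = ∀ g g' g'' → w ∈ edge g → w ∈ edge g' → w ∈ edge g'' →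
                     g ≡ g' ⊎ g ≡ g'' ⊎ g' ≡ g''

  -- Three distinct edges at w would give deg w ≥ 3.
  deg≤2⇒at-most-two : ∀ w → deg H w ≤ 2 → AtMostTwoEdges w
  deg≤2⇒at-most-two w deg≤2 g g' g'' w∈g w∈g' w∈g''
    with g ≟F g' | g ≟F g'' | g' ≟F g''
  ... | yes e | _ | _ = inj₁ e
  ... | no _ | yes e | _ = inj₂ (inj₁ e)
  ... | no _ | no _ | yes e = inj₂ (inj₂ e)
  ... | no g≢g' | no g≢g'' | no g'≢g'' =
        ⊥-elim (<⇒≱ (three-members (∈⟦⟧⁺ at w∈g) (∈⟦⟧⁺ at w∈g') (∈⟦⟧⁺ at w∈g'')
                                   g≢g' g≢g'' g'≢g'') deg≤2)
    where
    at : ∀ i → Dec (w ∈ edge i)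
    at i = w ∈? edge i

  high-degree-in-edge : ∀ w → w ∈ highDeg H → ∃[ i ] (w ∈ edge i)
  high-degree-in-edge w w∈high
    with positive-size⇒nonempty _ (≤-trans (s≤s z≤n) (∈⟦⟧⁻ (λ v → 3 ≤ℕ? deg H v) w∈high))
  ... | i , i∈ = i , ∈⟦⟧⁻ (λ i → w ∈? edge i) i∈

  Crosses : Subset n → Fin m → Set
  Crosses S f = ∃[ w ] ∃[ z ] (w ∈ S × w ∈ edge f × z ∈ edge f × z ∉ S)

  walk-crosses : ∀ ℓ (vs : Fin (suc ℓ) → Fin n) (es : Fin ℓ → Fin m) {S} →
                 vs zero ∈ S → vs (fromℕ ℓ) ∉ S →
                 (∀ k → vs (inject₁ k) ∈ edge (es k) × vs (suc k) ∈ edge (es k)) →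
                 ∃[ f ] Crosses S f
  walk-crosses zero vs es start∈ end∉ links = ⊥-elim (end∉ start∈)
  walk-crosses (suc ℓ) vs es {S} start∈ end∉ links with vs (suc zero) ∈? S
  ... | yes next∈ = walk-crosses ℓ (vs ∘′ suc) (es ∘′ suc) next∈ end∉ (λ k → links (suc k))
  ... | no next∉ = es zero , vs zero , vs (suc zero) ,
                   start∈ , proj₁ (links zero) , proj₂ (links zero) , next∉

  record Spreading (S : Subset n) : Set where
    field
      one-open-edge : ∀ w g g' → w ∈ S → w ∈ edge g → w ∈ edge g' → g ≢ g' →
                      edge g ⊆ S ⊎ edge g' ⊆ S
      low-degree-outside : ∀ w → w ∉ S → AtMostTwoEdges w
  open Spreading

  -- A crossing edge is the only open edge at its observed vertex, so a
  -- power domination step from that vertex observes the whole edge.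
  observe-crossing : ∀ {S f} → Spreading S → Crosses S f → PDStep H S (S ∪ edge f)
  observe-crossing {S} {f} inv (w , z , w∈S , w∈f , z∈f , z∉S) = w , f , w∈S , w∈f , forced , spec
    where
    forced : ∀ x → N⟨_⟩ H w x → x ∉ S → x ∈ edge f
    forced x ((g , w∈g , x∈g) , _) x∉S with g ≟F f
    ... | yes refl = x∈g
    ... | no g≢f with one-open-edge inv w g f w∈S w∈g w∈f g≢f
    ...   | inj₁ g⊆S = ⊥-elim (x∉S (g⊆S x∈g))
    ...   | inj₂ f⊆S = ⊥-elim (z∉S (f⊆S z∈f))
    spec : ∀ x → (x ∈ S ∪ edge f → x ∈ S ⊎ N⟨_⟩ H w x) × (x ∈ S ⊎ N⟨_⟩ H w x → x ∈ S ∪ edge f)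
    spec x = observed , new
      where
      observed : x ∈ S ∪ edge f → x ∈ S ⊎ N⟨_⟩ H w x
      observed x∈ with x∈p∪q⁻ S (edge f) x∈ | x ≟F w
      ... | inj₁ x∈S | _ = inj₁ x∈S
      ... | inj₂ _ | yes refl = inj₁ w∈S
      ... | inj₂ x∈f | no x≢w = inj₂ ((f , w∈f , x∈f) , x≢w)
      new : x ∈ S ⊎ N⟨_⟩ H w x → x ∈ S ∪ edge f
      new (inj₁ x∈S) = p⊆p∪q (edge f) x∈S
      new (inj₂ x∼w) with x ∈? S
      ... | yes x∈S = p⊆p∪q (edge f) x∈S
      ... | no x∉S = q⊆p∪q S (edge f) (forced x x∼w x∉S)

  -- Observing a whole edge preserves the invariant: a newly observed vertex
  -- has at most two edges, one of which is now observed.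
  spreading-∪ : ∀ {S} f → Spreading S → Spreading (S ∪ edge f)
  one-open-edge (spreading-∪ {S} f inv) w g g' w∈ w∈g w∈g' g≢g' with w ∈? S
  ... | yes w∈S = map-⊎ enlarge enlarge (one-open-edge inv w g g' w∈S w∈g w∈g' g≢g')
    where
    enlarge : ∀ {h} → edge h ⊆ S → edge h ⊆ S ∪ edge f
    enlarge h⊆S x∈ = p⊆p∪q (edge f) (h⊆S x∈)
  ... | no w∉S with x∈p∪q⁻ S (edge f) w∈
  ...   | inj₁ w∈S = ⊥-elim (w∉S w∈S)
  ...   | inj₂ w∈f with low-degree-outside inv w w∉S g g' f w∈g w∈g' w∈f
  ...     | inj₁ g≡g' = ⊥-elim (g≢g' g≡g')
  ...     | inj₂ (inj₁ refl) = inj₁ (q⊆p∪q S (edge f))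
  ...     | inj₂ (inj₂ refl) = inj₂ (q⊆p∪q S (edge f))
  low-degree-outside (spreading-∪ {S} f inv) w w∉ = low-degree-outside inv w (w∉ ∘′ p⊆p∪q (edge f))

  spread : Connected H → ∀ {S u} → Acc _⊃_ S → Spreading S → u ∈ S → PD.Reachable S
  spread conn {S} {u} (acc larger) inv u∈S with all? (λ x → x ∈? S)
  ... | yes full = S , ε , full
  ... | no not-full with ¬∀⟶∃¬ n _ (λ x → x ∈? S) not-full
  ...   | y , y∉S with conn u y
  ...     | ℓ , vs , es , _ , _ , refl , refl , links with walk-crosses ℓ vs es u∈S y∉S links
  ...       | f , crossing@(_ , z , _ , _ , z∈f , z∉S) with
                spread conn (larger grows) (spreading-∪ f inv) (p⊆p∪q (edge f) u∈S)
    where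
    grows : S ⊂ S ∪ edge f
    grows = p⊆p∪q (edge f) , z , q⊆p∪q S (edge f) z∈f , z∉S
  ...         | T , run , full = T , observe-crossing inv crossing ◅ run , full

  initial-spreading : ∀ S0 → (∀ w → w ∈ S0 ⊎ AtMostTwoEdges w) → (∀ w → w ∈ S0 → ∃[ i ] (w ∈ edge i)) →
                      Spreading (initial S0)
  one-open-edge (initial-spreading S0 low-or-chosen _) w g g' w∈ w∈g w∈g' g≢g'
    with ∈⟦⟧⁻ (dominated? S0) w∈ | low-or-chosen w
  ... | _ | inj₁ w∈S0 = inj₁ (λ x∈g → ∈⟦⟧⁺ (dominated? S0) (w , w∈S0 , g , w∈g , x∈g))
  ... | v , v∈S0 , e , v∈e , w∈e | inj₂ two with two g g' e w∈g w∈g' w∈e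
  ...   | inj₁ g≡g' = ⊥-elim (g≢g' g≡g')
  ...   | inj₂ (inj₁ refl) = inj₁ (λ x∈g → ∈⟦⟧⁺ (dominated? S0) (v , v∈S0 , g , v∈e , x∈g))
  ...   | inj₂ (inj₂ refl) = inj₂ (λ x∈g' → ∈⟦⟧⁺ (dominated? S0) (v , v∈S0 , g' , v∈e , x∈g'))
  low-degree-outside (initial-spreading S0 low-or-chosen in-edge) w w∉ with low-or-chosen w
  ... | inj₂ two = two
  ... | inj₁ w∈S0 with in-edge w w∈S0
  ...   | i , w∈i = ⊥-elim (w∉ (∈⟦⟧⁺ (dominated? S0) (w , w∈S0 , i , w∈i , w∈i)))

  spreading-dominates : Connected H → ∀ S0 {u} → u ∈ S0 →
                        (∀ w → w ∈ S0 ⊎ AtMostTwoEdges w) → (∀ w → w ∈ S0 → ∃[ i ] (w ∈ edge i)) →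
                        PowerDominating H S0
  spreading-dominates conn S0 {u} u∈S0 low-or-chosen in-edge with in-edge u u∈S0
  ... | i , u∈i with spread conn (⊃-wellFounded _) (initial-spreading S0 low-or-chosen in-edge)
                       (∈⟦⟧⁺ (dominated? S0) (u , u∈S0 , i , u∈i , u∈i))
  ...   | T , run , full = initial S0 , T , initial-spec S0 , run , full

  dominating-nonempty : ∀ {Step : Subset n → Subset n → Set} → (∀ {S S'} → Step S S' → Nonempty S) →
                        Fin n → ∀ S0 → ∃[ S ] ∃[ T ] (InitialSet H S0 S × Star Step S T × Full T) →
                        1 ≤ ∣ S0 ∣
  dominating-nonempty starts u S0 (S , T , spec , run , full) with observed run full
    where
    observed : ∀ {T} → Star _ S T → Full T → Nonempty S
    observed ε full = u , full u
    observed (step ◅ _) _ = starts step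
  ... | x , x∈S with proj₁ (spec x) x∈S
  ...   | v , v∈S0 , _ = member-counts v∈S0 z≤n

  pd-starts-observed : ∀ {S S'} → PDStep H S S' → Nonempty S
  pd-starts-observed (v , _ , v∈S , _) = v , v∈S

  ipd-starts-observed : ∀ {S S'} → IPDStep H S S' → Nonempty S
  ipd-starts-observed (_ , _ , (a , a∈A) , A⊆S , _) = a , A⊆S a∈A

  high-degree-dominates : Connected H → ∃[ v ] (3 ≤ deg H v) → PowerDominating H (highDeg H)
  high-degree-dominates conn (v , 3≤deg) =
    spreading-dominates conn (highDeg H) {v} (∈⟦⟧⁺ high? 3≤deg) high-or-low high-degree-in-edge
    where
    high? : ∀ w → Dec (3 ≤ deg H w)
    high? w = 3 ≤ℕ? deg H w
    high-or-low : ∀ w → w ∈ highDeg H ⊎ AtMostTwoEdges w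
    high-or-low w with high? w
    ... | yes 3≤ = inj₁ (∈⟦⟧⁺ high? 3≤)
    ... | no 3≰ = inj₂ (deg≤2⇒at-most-two w (≤-pred (≰⇒> 3≰)))

  -- γ_P exists and is at most |highDeg|; γ_{P_I} exists and is at most γ_P,
  -- because a minimum power dominating set is infectious power dominating.
  high-degree-case : Connected H → ∃[ v ] (3 ≤ deg H v) →
                     ∃[ kI ] ∃[ kP ] (IsγPI H kI × IsγP H kP × kI ≤ kP × kP ≤ ∣ highDeg H ∣)
  high-degree-case conn high
    with high-degree-dominates conn high
  ... | pd-high
    with minimum-exists (PowerDominating H) power-dominating? (highDeg H) pd-high
       | minimum-exists (InfPowerDominating H) inf-power-dominating? (highDeg H) (pd⇒ipd _ pd-high)
  ... | kP , γP@((SP , pd-SP , refl) , minimalP) | kI , γPI@(_ , minimalI) =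
        kI , kP , γPI , γP , minimalI SP (pd⇒ipd SP pd-SP) , minimalP (highDeg H) pd-high

  low-degree-case : Connected H → (∀ v → deg H v ≤ 2) → IsγPI H 1 × IsγP H 1
  low-degree-case conn deg≤2 with nonempty (some-index hasEdge)
  ... | u , u∈e =
        ((⁅ u ⁆ , pd⇒ipd _ pd-u , ∣⁅x⁆∣≡1 u) , dominating-nonempty ipd-starts-observed u) ,
        ((⁅ u ⁆ , pd-u , ∣⁅x⁆∣≡1 u) , dominating-nonempty pd-starts-observed u)
    where
    in-edge : ∀ w → w ∈ ⁅ u ⁆ → ∃[ i ] (w ∈ edge i)
    in-edge w w∈ = some-index hasEdge , subst (_∈ edge _) (sym (x∈⁅y⁆⇒x≡y u w∈)) u∈e
    pd-u : PowerDominating H ⁅ u ⁆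
    pd-u = spreading-dominates conn ⁅ u ⁆ (x∈⁅x⁆ u)
             (λ w → inj₂ (deg≤2⇒at-most-two w (deg≤2 w))) in-edge

proposition4p1 : (H : Hypergraph) → Connected H →
    ((∃[ v ] (3 ≤ deg H v)) →
      ∃[ kI ] ∃[ kP ] (IsγPI H kI × IsγP H kP × kI ≤ kP × kP ≤ ∣ highDeg H ∣))
    × ((∀ v → deg H v ≤ 2) → IsγPI H 1 × IsγP H 1)
proposition4p1 H conn = high-degree-case H conn , low-degree-case H conn
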